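{- For every natural number $n$, the triple $\{\mathsf{true}\}\ x:=0;\ \mathsf{while}\ \mathsf{true}\ \mathsf{do}\ x:=x+1\ \{\mathit{finite}\ast\ast\langle x=n\rangle\ast\ast\mathsf{true}\}$ is derivable in the trace-based Hoare logic.
   Context: While statements: $s ::= x:=e \mid \mathsf{skip}\mid s_0;s_1\mid \mathsf{if}\ e\ \mathsf{then}\ s_t\ \mathsf{else}\ s_f\mid \mathsf{while}\ e\ \mathsf{do}\ s_t$; a state $\sigma$ assigns integers to variables, $[\![e]\!]\sigma$ is the value of $e$, $\sigma\models e$ means $e$ is true in $\sigma$; $x=n$ is the state predicate "the value of $x$ is $n$". The metatheory is constructive. Traces are coinductive: $\langle\sigma\rangle$, and $\sigma::\tau$ for a trace $\tau$; bisimilarity $\approx$ is coinductive; $\mathit{hd}\langle\sigma\rangle=\mathit{hd}(\sigma::\tau)=\sigma$; $\tau\downarrow\sigma$ is inductive: $\langle\sigma\rangle\downarrow\sigma$, $\sigma::\tau\downarrow\sigma'$ if $\tau\downarrow\sigma'$; $\mathit{finite}$ holds of $\tau$ iff $\tau\downarrow\sigma$ for some $\sigma$. State predicates are arbitrary; trace predicates are setoid predicates (invariant under $\approx$); $\mathsf{true},\wedge,\neg,\exists$ are pointwise; $\models$ is entailment. $\langle U\rangle$ holds exactly of $\langle\sigma\rangle$ with $\sigma\models U$; $\mathrm{dup}(U)$ exactly of $\sigma::\langle\sigma\rangle$ with $\sigma\models U$; $U[x\mapsto e]$ exactly of $\sigma::\langle\sigma[x\mapsto[\![e]\!]\sigma]\rangle$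 with $\sigma\models U$. $\mathrm{follows}_Q(\tau,\tau')$ is coinductive: $\mathrm{follows}_Q(\langle\sigma\rangle,\tau)$ if $\mathit{hd}\,\tau=\sigma$ and $\tau\models Q$; $\mathrm{follows}_Q(\sigma::\tau,\sigma::\tau')$ if $\mathrm{follows}_Q(\tau,\tau')$. $\tau'\models P\ast\ast Q$ iff $\exists\tau$, $\tau\models P$ and $\mathrm{follows}_Q(\tau,\tau')$ (chains associate to the right). $P^{\dagger}$ is coinductive: $\tau\models P^{\dagger}$ if $\tau\models\langle\mathsf{true}\rangle$; $\tau'\models P^{\dagger}$ if $\exists\tau$, $\tau\models P$ and $\mathrm{follows}_{P^{\dagger}}(\tau,\tau')$. The trace-based Hoare logic derives $\{U\}\,s\,\{P\}$ inductively by: $\{U\}\,x:=e\,\{U[x\mapsto e]\}$; $\{U\}\,\mathsf{skip}\,\{\langle U\rangle\}$; from $\{U\}\,s_0\,\{P\ast\ast\langle V\rangle\}$ and $\{V\}\,s_1\,\{Q\}$ infer $\{U\}\,s_0;s_1\,\{P\ast\ast Q\}$; from $\{e\wedge U\}\,s_t\,\{P\}$ and $\{\neg e\wedge U\}\,s_f\,\{P\}$ infer $\{U\}\,\mathsf{if}\ e\ \mathsf{then}\ s_t\ \mathsf{else}\ s_f\,\{\mathrm{dup}(U)\ast\ast P\}$; from $U\models I$ and $\{e\wedge I\}\,s_t\,\{P\ast\ast\langle I\rangle\}$ infer $\{U\}\,\mathsf{while}\ e\ \mathsf{do}\ s_t\,\{\mathrm{dup}(U)\ast\ast(P\ast\ast\mathrm{dup}(I))^{\dagger}\ast\ast\langle\neg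 e\rangle\}$; from $U\models U'$, $\{U'\}\,s\,\{P'\}$, $P'\models P$ infer $\{U\}\,s\,\{P\}$; from $\forall z.\ \{U_z\}\,s\,\{P_z\}$ infer $\{\exists z.U_z\}\,s\,\{\exists z.P_z\}$. -}

module Defs where

open import Data.Nat using (ℕ; zero; suc; _≡ᵇ_)
open import Data.Maybe using (Maybe; just; nothing; is-just)
open import Data.Bool using (T)
open import Data.Sum using (_⊎_; inj₁; inj₂)
open import Level using (Lift; lift; lower; 0ℓ) renaming (suc to lsuc)
open import Data.Integer using (ℤ; +_; _+_; _-_; _*_)
open import Data.Bool using (if_then_else_)
open import Data.Product using (Σ; _×_; _,_; proj₁; proj₂)
open import Data.Unit using (⊤; tt)
open import Data.Empty using (⊥)
open import Relation.Nullary using (¬_)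
open import Relation.Binary.PropositionalEquality using (_≡_; refl; sym; trans; subst)

Var : Set
Var = ℕ

-- Integer-valued expressions; an expression is "true" iff its value is nonzero.
data Expr : Set where
  num  : ℤ → Expr
  var  : Var → Expr
  _⊕_  : Expr → Expr → Expr
  _⊖_  : Expr → Expr → Expr
  _⊛_  : Expr → Expr → Expr

data Stmt : Set where
  _≔_          : Var → Expr → Stmt
  skip         : Stmt
  _⨾_          : Stmt → Stmt → Stmt
  If_then_else_ : Expr → Stmt → Stmt → Stmt
  while_do'_   : Expr → Stmt → Stmt

infix  30 _≔_
infixl 40 _⊕_ _⊖_
infixl 45 _⊛_
infix  10 while_do'_
infixr 20 _⨾_

State : Set
State = Var → ℤ

⟦_⟧ : Expr → State → ℤ
⟦ num n ⟧ σ = n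
⟦ var y ⟧ σ = σ y
⟦ e ⊕ f ⟧ σ = ⟦ e ⟧ σ + ⟦ f ⟧ σ
⟦ e ⊖ f ⟧ σ = ⟦ e ⟧ σ - ⟦ f ⟧ σ
⟦ e ⊛ f ⟧ σ = ⟦ e ⟧ σ * ⟦ f ⟧ σ

_[_↦_] : State → Var → ℤ → State
(σ [ x ↦ v ]) y = if y ≡ᵇ x then v else σ y

etrue : Expr
etrue = num (+ 1)

Assertion : Set₁
Assertion = State → Set

⌜_⌝ : Expr → Assertion
⌜ e ⌝ σ = ¬ (⟦ e ⟧ σ ≡ + 0)

_∧ₐ_ : Assertion → Assertion → Assertion
(U ∧ₐ V) σ = U σ × V σ

¬ₐ_ : Assertion → Assertion
(¬ₐ U) σ = ¬ U σ

trueₐ : Assertion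
trueₐ σ = ⊤

∃ₐ : {Z : Set} → (Z → Assertion) → Assertion
∃ₐ {Z} U σ = Σ Z (λ z → U z σ)

_⊨ₐ_ : Assertion → Assertion → Set
U ⊨ₐ V = ∀ σ → U σ → V σ

_≐_ : Var → ℤ → Assertion
(x ≐ n) σ = σ x ≡ n

-- Coinductive types (--guardedness / --sized-types) are unavailable, so a
-- (possibly infinite, nonempty) trace is represented by its head state and
-- the partial function of the remaining positions; once a position is
-- undefined, all later positions are undefined.  This is a faithful
-- representation of the final coalgebra of  Trace = State + State × Trace.

record Trace : Set where
  field
    hd  : State
    tl  : ℕ → Maybe State
    ok  : ∀ i → T (is-just (tl (suc i))) → T (is-just (tl i))

open Trace public

⟨_⟩ : State → Trace
hd ⟨ σ ⟩ = σ
tl ⟨ σ ⟩ i = nothing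
ok ⟨ σ ⟩ i ()

_∷_ : State → Trace → Trace
hd (σ ∷ τ) = σ
tl (σ ∷ τ) zero = just (hd τ)
tl (σ ∷ τ) (suc i) = tl τ i
ok (σ ∷ τ) zero _ = tt
ok (σ ∷ τ) (suc i) h = ok τ i h

infixr 5 _∷_

-- Bisimilarity (for this representation, the coinductive bisimilarity is
-- exactly pointwise equality of all positions).
record _≈_ (a b : Trace) : Set where
  constructor mk≈
  field
    hd≈ : hd a ≡ hd b
    tl≈ : ∀ i → tl a i ≡ tl b i

open _≈_ public

≈-refl : ∀ {a} → a ≈ a
≈-refl = mk≈ refl (λ _ → refl)

≈-sym : ∀ {a b} → a ≈ b → b ≈ a
≈-sym (mk≈ h t) = mk≈ (sym h) (λ i → sym (t i))

≈-trans : ∀ {a b c} → a ≈ b → b ≈ c → a ≈ c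
≈-trans (mk≈ h t) (mk≈ h' t') = mk≈ (trans h h') (λ i → trans (t i) (t' i))

data _↓_ : Trace → State → Set where
  ↓⟨⟩ : ∀ {τ σ} → τ ≈ ⟨ σ ⟩ → τ ↓ σ
  ↓∷  : ∀ {τ σ τ' σ'} → τ ≈ (σ ∷ τ') → τ' ↓ σ' → τ ↓ σ'

↓-resp : ∀ {a b σ} → a ≈ b → a ↓ σ → b ↓ σ
↓-resp e (↓⟨⟩ h) = ↓⟨⟩ (≈-trans (≈-sym e) h)
↓-resp e (↓∷ h d) = ↓∷ (≈-trans (≈-sym e) h) d

-- Coinductive predicates are encoded as greatest fixed points
-- (unions of post-fixed points, Knaster–Tarski).

-- one unfolding of follows_Q, with R for the coinductive occurrence
FollowsStep : (Trace → Set₁) → (Trace → Trace → Set) → Trace → Trace → Set₁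
FollowsStep Q R a b =
    (Σ State λ σ → Lift (lsuc 0ℓ) (a ≈ ⟨ σ ⟩ × hd b ≡ σ) × Q b)
  ⊎ Lift (lsuc 0ℓ) (Σ State λ σ → Σ Trace λ a' → Σ Trace λ b' →
                     a ≈ (σ ∷ a') × b ≈ (σ ∷ b') × R a' b')

Follows : (Trace → Set₁) → Trace → Trace → Set₁
Follows Q a b = Σ (Trace → Trace → Set) λ R →
                  Lift (lsuc 0ℓ) (R a b) × (∀ a' b' → R a' b' → FollowsStep Q R a' b')

Last : Assertion → Trace → Set
Last U τ = Σ State λ σ → U σ × τ ≈ ⟨ σ ⟩

Dup : Assertion → Trace → Set
Dup U τ = Σ State λ σ → U σ × τ ≈ (σ ∷ ⟨ σ ⟩)

Upd : Assertion → Var → Expr → Trace → Set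
Upd U y e τ = Σ State λ σ → U σ × τ ≈ (σ ∷ ⟨ σ [ y ↦ ⟦ e ⟧ σ ] ⟩)

Chop : (Trace → Set₁) → (Trace → Set₁) → Trace → Set₁
Chop P Q τ' = Σ Trace (λ τ → P τ × Follows Q τ τ')

-- one unfolding of P†, with X for the coinductive occurrence
DaggerStep : (Trace → Set₁) → (Trace → Set) → Trace → Set₁
DaggerStep P X τ = Lift (lsuc 0ℓ) (Last trueₐ τ) ⊎ Σ Trace (λ τ₀ → P τ₀ × Follows (λ t → Lift (lsuc 0ℓ) (X t)) τ₀ τ)

Dagger : (Trace → Set₁) → Trace → Set₁
Dagger P τ = Σ (Trace → Set) λ X → Lift (lsuc 0ℓ) (X τ) × (∀ τ' → X τ' → DaggerStep P X τ')

record TPred : Set₂ where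
  field
    holds : Trace → Set₁
    resp  : ∀ {τ τ'} → τ ≈ τ' → holds τ → holds τ'

open TPred public

_⊨ₜ_ : TPred → TPred → Set₁
P ⊨ₜ Q = ∀ τ → holds P τ → holds Q τ

follows-mono-resp : ∀ {Q Q' : Trace → Set₁} →
  (∀ {a b} → a ≈ b → Q a → Q' b) → ∀ {τ a b} → Follows Q τ a → a ≈ b → Follows Q' τ b
follows-mono-resp {Q} {Q'} r {τ} {a} {b} (R , lift rab , post) eq =
  R' , lift (a , rab , eq) , step
  where
  R' : Trace → Trace → Set
  R' s t = Σ Trace λ u → R s u × u ≈ t
  step : ∀ s t → R' s t → FollowsStep Q' R' s t
  step s t (u , rsu , ut) with post s u rsu
  ... | inj₁ (σ , lift (sσ , hu) , q) = inj₁ (σ , lift (sσ , trans (sym (hd≈ ut)) hu) , r ut q)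
  ... | inj₂ (lift (σ , s' , u' , ss , uu , r')) =
        inj₂ (lift (σ , s' , u' , ss , ≈-trans (≈-sym ut) uu , (u' , r' , ≈-refl)))

dagger-resp : ∀ {P a b} → a ≈ b → Dagger P a → Dagger P b
dagger-resp {P} {a} {b} eq (X , lift xa , post) = X' , lift (a , xa , eq) , step
  where
  X' : Trace → Set
  X' t = Σ Trace λ u → X u × u ≈ t
  step : ∀ t → X' t → DaggerStep P X' t
  step t (u , xu , ut) with post u xu
  ... | inj₁ (lift (σ , tt' , uσ)) = inj₁ (lift (σ , tt' , ≈-trans (≈-sym ut) uσ))
  ... | inj₂ (τ₀ , p , f) =
        inj₂ (τ₀ , p , follows-mono-resp (λ {s} {s'} e (lift xs) → lift (s , xs , e)) f ut)

trueₜ : TPred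
holds trueₜ τ = Lift (lsuc 0ℓ) ⊤
resp  trueₜ _ _ = lift tt

finiteₜ : TPred
holds finiteₜ τ = Lift (lsuc 0ℓ) (Σ State (λ σ → τ ↓ σ))
resp  finiteₜ eq (lift (σ , h)) = lift (σ , ↓-resp eq h)

⟨_⟩ₜ : Assertion → TPred
holds ⟨ U ⟩ₜ τ = Lift (lsuc 0ℓ) (Last U τ)
resp ⟨ U ⟩ₜ eq (lift (σ , u , e)) = lift (σ , u , ≈-trans (≈-sym eq) e)

dup : Assertion → TPred
holds (dup U) τ = Lift (lsuc 0ℓ) (Dup U τ)
resp (dup U) eq (lift (σ , u , e)) = lift (σ , u , ≈-trans (≈-sym eq) e)

_[_↦_]ₜ : Assertion → Var → Expr → TPred
holds (U [ y ↦ e ]ₜ) τ = Lift (lsuc 0ℓ) (Upd U y e τ)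
resp (U [ y ↦ e ]ₜ) eq (lift (σ , u , h)) = lift (σ , u , ≈-trans (≈-sym eq) h)

infixr 5 _**_
_**_ : TPred → TPred → TPred
holds (P ** Q) = Chop (holds P) (holds Q)
resp (P ** Q) eq (τ , p , f) = τ , p , follows-mono-resp (resp Q) f eq

_† : TPred → TPred
holds (P †) = Dagger (holds P)
resp (P †) = dagger-resp

∃ₜ : {Z : Set} → (Z → TPred) → TPred
holds (∃ₜ {Z} P) τ = Σ (Lift (lsuc 0ℓ) Z) (λ z → holds (P (lower z)) τ)
resp (∃ₜ P) eq (z , p) = z , resp (P (lower z)) eq p

data ⊢ : Assertion → Stmt → TPred → Set₂ where
  h-assign : ∀ {U x e} → ⊢ (U) (x ≔ e) (U [ x ↦ e ]ₜ)
  h-skip   : ∀ {U} → ⊢ (U) (skip) (⟨ U ⟩ₜ)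
  h-seq    : ∀ {U V P Q s₀ s₁} →
             ⊢ (U) (s₀) (P ** ⟨ V ⟩ₜ) → ⊢ (V) (s₁) (Q) →
             ⊢ (U) (s₀ ⨾ s₁) (P ** Q)
  h-if     : ∀ {U P e sₜ s_f} →
             ⊢ (⌜ e ⌝ ∧ₐ U) (sₜ) (P) → ⊢ ((¬ₐ ⌜ e ⌝) ∧ₐ U) (s_f) (P) →
             ⊢ (U) (If e then sₜ else s_f) (dup U ** P)
  h-while  : ∀ {U I P e sₜ} →
             U ⊨ₐ I → ⊢ (⌜ e ⌝ ∧ₐ I) (sₜ) (P ** ⟨ I ⟩ₜ) →
             ⊢ (U) (while e do' sₜ) (dup U ** ((P ** dup I) †) ** ⟨ ¬ₐ ⌜ e ⌝ ⟩ₜ)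
  h-conseq : ∀ {U U' P P' s} →
             U ⊨ₐ U' → ⊢ (U') (s) (P') → P' ⊨ₜ P → ⊢ (U) (s) (P)
  h-ex     : ∀ {Z : Set} {U : Z → Assertion} {P : Z → TPred} {s} →
             (∀ z → ⊢ (U z) s (P z)) → ⊢ (∃ₐ U) s (∃ₜ P)

x : Var
x = 0

prog : Stmt
prog = (x ≔ num (+ 0)) ⨾ (while etrue do' (x ≔ var x ⊕ num (+ 1)))

module Submission where

-- The derivation itself is the obvious one (assignment, sequencing, the while
-- rule with invariant true); the work lies in the final consequence step,
-- showing that the trace predicate produced by the rules entails the goal.

open import Defs
open import Data.Nat using (ℕ; zero; suc) renaming (_+_ to _+ℕ_)
open import Data.Nat.Properties using (+-identityʳ; +-assoc)
open import Data.Integer using (+_; _+_)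
open import Data.Maybe.Properties using (just-injective)
open import Data.Sum using (_⊎_; inj₁; inj₂)
open import Data.Product using (Σ; _×_; _,_)
open import Data.Unit using (tt)
open import Data.Empty using (⊥; ⊥-elim)
open import Level using (lift)
open import Relation.Binary.PropositionalEquality using (_≡_; refl; sym; trans; subst; cong)

∷-inj : ∀ {σ σ' a a'} → (σ ∷ a) ≈ (σ' ∷ a') → σ ≡ σ' × a ≈ a'
∷-inj e = hd≈ e , mk≈ (just-injective (tl≈ e 0)) (λ i → tl≈ e (suc i))

⟨⟩≉∷ : ∀ {σ σ' a} → ⟨ σ ⟩ ≈ (σ' ∷ a) → ⊥
⟨⟩≉∷ e with tl≈ e 0
... | ()

data _≼_ : Trace → Trace → Set where
  here  : ∀ {τ} → τ ≼ τ
  later : ∀ {τ' τ σ τ₁} → τ ≈ (σ ∷ τ₁) → τ' ≼ τ₁ → τ' ≼ τ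

≼-trans : ∀ {τ₁ τ₂ τ₃} → τ₁ ≼ τ₂ → τ₂ ≼ τ₃ → τ₁ ≼ τ₃
≼-trans p here        = p
≼-trans p (later e q) = later e (≼-trans p q)

module _ {Q : Trace → Set₁} where

  follows-base : ∀ {σ b} → hd b ≡ σ → Q b → Follows Q ⟨ σ ⟩ b
  follows-base {σ} {b} h q = R , lift (refl , refl) , step
    where
    R : Trace → Trace → Set
    R s t = s ≡ ⟨ σ ⟩ × t ≡ b
    step : ∀ s t → R s t → FollowsStep Q R s t
    step s t (refl , refl) = inj₁ (σ , lift (≈-refl , h) , q)

  follows-cons : ∀ {σ a b} → Follows Q a b → Follows Q (σ ∷ a) (σ ∷ b)
  follows-cons {σ} {a} {b} (R , lift rab , post) = R' , lift (inj₂ (refl , refl)) , step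
    where
    R' : Trace → Trace → Set
    R' s t = R s t ⊎ (s ≡ σ ∷ a × t ≡ σ ∷ b)
    step : ∀ s t → R' s t → FollowsStep Q R' s t
    step s t (inj₁ r) with post s t r
    ... | inj₁ z = inj₁ z
    ... | inj₂ (lift (σ' , s' , t' , e₁ , e₂ , r')) =
          inj₂ (lift (σ' , s' , t' , e₁ , e₂ , inj₁ r'))
    step s t (inj₂ (refl , refl)) = inj₂ (lift (σ , a , b , ≈-refl , ≈-refl , inj₁ rab))

  follows-left : ∀ {a a₂ b} → Follows Q a b → a ≈ a₂ → Follows Q a₂ b
  follows-left {a} {a₂} {b} (R , lift rab , post) e = R' , lift (a , e , rab) , step
    where
    R' : Trace → Trace → Set
    R' s t = Σ Trace λ u → u ≈ s × R u t
    step : ∀ s t → R' s t → FollowsStep Q R' s t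
    step s t (u , us , r) with post u t r
    ... | inj₁ (σ , lift (uσ , h) , q) = inj₁ (σ , lift (≈-trans (≈-sym us) uσ , h) , q)
    ... | inj₂ (lift (σ , u' , t' , e₁ , e₂ , r')) =
          inj₂ (lift (σ , u' , t' , ≈-trans (≈-sym us) e₁ , e₂ , (u' , ≈-refl , r')))

  follows-cons-inv : ∀ {σ a a₁ b} → Follows Q a b → a ≈ (σ ∷ a₁) →
                     Σ Trace λ b₁ → b ≈ (σ ∷ b₁) × Follows Q a₁ b₁
  follows-cons-inv {σ} {a} {a₁} {b} (R , lift r , post) e with post a b r
  ... | inj₁ (_ , lift (aσ , _) , _) = ⊥-elim (⟨⟩≉∷ (≈-trans (≈-sym aσ) e))
  ... | inj₂ (lift (σ' , a' , b' , ea , eb , r')) with ∷-inj (≈-trans (≈-sym ea) e)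
  ... | σ'≡σ , a'≈a₁ =
        b' , subst (λ s → b ≈ (s ∷ b')) σ'≡σ eb , follows-left (R , lift r' , post) a'≈a₁

  follows-end : ∀ {σ a b} → Follows Q a b → a ≈ ⟨ σ ⟩ → hd b ≡ σ × Q b
  follows-end {σ} {a} {b} (R , lift r , post) e with post a b r
  ... | inj₁ (_ , lift (aσ , h) , q) = trans h (hd≈ (≈-trans (≈-sym aσ) e)) , q
  ... | inj₂ (lift (_ , _ , _ , ea , _ , _)) = ⊥-elim (⟨⟩≉∷ (≈-trans (≈-sym e) ea))

  follows-hd : ∀ {a b} → Follows Q a b → hd b ≡ hd a
  follows-hd {a} {b} (R , lift r , post) with post a b r
  ... | inj₁ (_ , lift (aσ , h) , _) = trans h (sym (hd≈ aσ))
  ... | inj₂ (lift (_ , _ , _ , ea , eb , _)) = trans (hd≈ eb) (sym (hd≈ ea))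

  follows-suffix : ∀ {a a' b} → Follows Q a b → a' ≼ a →
                   Σ Trace λ b' → b' ≼ b × Follows Q a' b'
  follows-suffix F here = _ , here , F
  follows-suffix F (later e s) with follows-cons-inv F e
  ... | b₁ , b≈ , F₁ with follows-suffix F₁ s
  ... | b' , s' , F' = b' , later b≈ s' , F'

  chop-suffix : ∀ {σ a b} → Follows Q a b → ⟨ σ ⟩ ≼ a →
                Σ Trace λ b' → b' ≼ b × hd b' ≡ σ × Q b'
  chop-suffix F s with follows-suffix F s
  ... | b' , s' , F' with follows-end F' ≈-refl
  ... | h , q = b' , s' , h , q

-- A trace with a suffix starting in a V-state satisfies finite ** ⟨V⟩ ** true:
-- the finite prefix is the part before the suffix.
suffix-reaches : ∀ {V : Assertion} {τ' τ} → τ' ≼ τ → V (hd τ') →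
                 holds (finiteₜ ** ⟨ V ⟩ₜ ** trueₜ) τ
suffix-reaches {V} {τ} here v =
  ⟨ hd τ ⟩ , lift (hd τ , ↓⟨⟩ ≈-refl) ,
  follows-base refl (⟨ hd τ ⟩ , lift (hd τ , v , ≈-refl) , follows-base refl (lift tt))
suffix-reaches {V} (later {σ = σ} e s) v with suffix-reaches s v
... | τp , lift (σf , fin) , F =
  (σ ∷ τp) , lift (σf , ↓∷ ≈-refl fin) ,
  follows-mono-resp (resp (⟨ V ⟩ₜ ** trueₜ)) (follows-cons F) (≈-sym e)

-- An assignment ends in any assertion V that the update establishes, which is
-- the form of postcondition the sequencing rule requires of its first part.
assign-ends-in : ∀ {U V : Assertion} {y e} → (∀ σ → U σ → V (σ [ y ↦ ⟦ e ⟧ σ ])) →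
                 (U [ y ↦ e ]ₜ) ⊨ₜ ((U [ y ↦ e ]ₜ) ** ⟨ V ⟩ₜ)
assign-ends-in {U} {V} {y} {e} hv τ (lift (σ , u , eq)) =
  (σ ∷ ⟨ σ [ y ↦ ⟦ e ⟧ σ ] ⟩) , lift (σ , u , ≈-refl) ,
  follows-mono-resp (resp ⟨ V ⟩ₜ)
    (follows-cons (follows-base refl (lift (_ , hv σ u , ≈-refl)))) (≈-sym eq)

-- The trace predicate of one iteration of  while true do y := e  as produced
-- by the while rule with invariant I: the assignment followed by dup I.
Iteration : Assertion → Var → Expr → TPred
Iteration I y e = ((⌜ etrue ⌝ ∧ₐ I) [ y ↦ e ]ₜ) ** dup I

Halt : TPred
Halt = ⟨ ¬ₐ ⌜ etrue ⌝ ⟩ₜ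

module Loop (I : Assertion) (y : Var) (e : Expr) where

  next : State → State
  next σ = σ [ y ↦ ⟦ e ⟧ σ ]

  iteration-shape : ∀ {τ} → holds (Iteration I y e) τ →
                    Σ State λ σ → hd τ ≡ σ × ⟨ next σ ⟩ ≼ τ
  iteration-shape (τ₁ , lift (σ , _ , τ₁≈) , F) with chop-suffix F (later τ₁≈ here)
  ... | τ₀ , s , hd₀ , lift (_ , _ , τ₀≈) =
    σ , trans (follows-hd F) (hd≈ τ₁≈) ,
    ≼-trans ends-in-next s
    where
    -- τ₀ is dup I, i.e. a two-state trace whose states equal its head.
    ends-in-next : ⟨ next σ ⟩ ≼ τ₀
    ends-in-next = subst (λ σ' → ⟨ σ' ⟩ ≼ τ₀) (trans (sym (hd≈ τ₀≈)) hd₀) (later τ₀≈ here)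

  -- One unfolding of (Iteration I y e)†, given by a post-fixed point X, when
  -- followed by Halt: the halting alternative is impossible, so the loop
  -- performs one more iteration, reaching a new X-trace that starts in the
  -- updated state and whose continuation is a suffix of the original one.
  module _ {X : Trace → Set}
           (post : ∀ τ → X τ → DaggerStep (holds (Iteration I y e)) X τ) where

    iterate : ∀ {τd τ} → X τd → Follows (holds Halt) τd τ →
              Σ Trace λ τd' → Σ Trace λ τ' →
                X τd' × Follows (holds Halt) τd' τ' × τ' ≼ τ × hd τd' ≡ next (hd τd)
    iterate {τd} xd F with post τd xd
    ... | inj₁ (lift (_ , _ , τd≈)) with follows-end F τd≈
    ...   | _ , lift (_ , guard-fails , _) = ⊥-elim (guard-fails (λ ()))
    iterate {τd} xd F | inj₂ (τ₀ , body , F₀) with iteration-shape body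
    ... | σ , hdτ₀ , s with chop-suffix F₀ s
    ... | τd' , s' , hd' , lift xd' with follows-suffix F s'
    ... | τ' , s'' , F' =
      τd' , τ' , xd' , F' , s'' , trans hd' (cong next σ≡hd)
      where
      σ≡hd : σ ≡ hd τd
      σ≡hd = trans (sym hdτ₀) (sym (follows-hd F₀))

increment : Expr
increment = var x ⊕ num (+ 1)

count : ∀ {I X} (post : ∀ τ → X τ → DaggerStep (holds (Iteration I x increment)) X τ) →
        ∀ d {k τd τ} → X τd → Follows (holds Halt) τd τ → hd τd x ≡ + k →
        Σ Trace λ τ' → τ' ≼ τ × hd τ' x ≡ + (k +ℕ d)
count post zero {k} {τ = τ} xd F hx =
  τ , here , trans (cong (λ σ → σ x) (follows-hd F)) (trans hx (cong +_ (sym (+-identityʳ k))))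
count {I} post (suc d) {k} xd F hx with Loop.iterate I x increment post xd F
... | τd' , τ' , xd' , F' , s , hd' with count post d xd' F' x-incremented
  where
  x-incremented : hd τd' x ≡ + (k +ℕ 1)
  x-incremented = trans (cong (λ σ → σ x) hd') (cong (_+ + 1) hx)
... | τ'' , s' , hx'' = τ'' , ≼-trans s' s , trans hx'' (cong +_ (+-assoc k 1 d))

ProgPost : TPred
ProgPost =
  (trueₐ [ x ↦ num (+ 0) ]ₜ) ** dup (x ≐ (+ 0)) ** (Iteration trueₐ x increment †) ** Halt

prog-derivation : ⊢ trueₐ prog ProgPost
prog-derivation =
  h-seq {P = trueₐ [ x ↦ num (+ 0) ]ₜ} initialise
        (h-while {U = x ≐ (+ 0)} {I = trueₐ} {P = (⌜ etrue ⌝ ∧ₐ trueₐ) [ x ↦ increment ]ₜ}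
                 (λ _ _ → tt) loop-body)
  where
  initialise : ⊢ trueₐ (x ≔ num (+ 0)) ((trueₐ [ x ↦ num (+ 0) ]ₜ) ** ⟨ x ≐ (+ 0) ⟩ₜ)
  initialise = h-conseq (λ _ u → u) h-assign (assign-ends-in {e = num (+ 0)} (λ _ _ → refl))

  loop-body : ⊢ (⌜ etrue ⌝ ∧ₐ trueₐ) (x ≔ increment)
                (((⌜ etrue ⌝ ∧ₐ trueₐ) [ x ↦ increment ]ₜ) ** ⟨ trueₐ ⟩ₜ)
  loop-body = h-conseq (λ _ u → u) h-assign (assign-ends-in {e = increment} (λ _ _ → tt))

-- Every trace of ProgPost passes through x = n: peel off x := 0 and dup(x = 0),
-- then run n iterations of the loop.
prog-post-reaches : ∀ n → ProgPost ⊨ₜ (finiteₜ ** ⟨ x ≐ (+ n) ⟩ₜ ** trueₜ)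
prog-post-reaches n τ (τa , lift (_ , _ , τa≈) , Fa)
  with chop-suffix Fa (later τa≈ here)
... | τ₁ , s₁ , _ , (τb , lift (_ , x≐0 , τb≈) , Fb) with chop-suffix Fb (later τb≈ here)
... | τ₂ , s₂ , hd₂ , (τd , (_ , lift xd , post) , Fd) with count post n xd Fd hx
  where
  hx : hd τd x ≡ + 0
  hx = trans (cong (λ σ → σ x) (trans (sym (follows-hd Fd)) hd₂)) x≐0
... | τ₃ , s₃ , hx₃ = suffix-reaches (≼-trans s₃ (≼-trans s₂ s₁)) hx₃

proposition5p5 : ∀ (n : ℕ) → ⊢ trueₐ prog (finiteₜ ** ⟨ x ≐ (+ n) ⟩ₜ ** trueₜ)
proposition5p5 n = h-conseq (λ _ u → u) prog-derivation (prog-post-reaches n)
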